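{- Let $f$ be an affine signal flow graph of sort $(n,m)$ with initial state $f_0$. For every finite computation $t\vdash f_0\to f_1\to\cdots\to f_N$ (with $t\le0$) whose transition at time $i$ has left label $u_i$ and right label $v_i$ ($t\le i\le t+N-1$), there exists a trajectory $\sigma\in\langle f\rangle$ such that $\sigma(i)=(u_i,v_i)$ for all $t\le i\le t+N-1$.
   Context: Fix a field $k$. Circuits and sorts $(n,m)$: generators copier $\Delta:(1,2)$, discard $!:(1,0)$, adder $\mu:(2,1)$, zero $\mathsf 0:(0,1)$, one $\mathsf 1:(0,1)$, register $\mathsf x:(1,1)$, amplifier $\mathsf s_r:(1,1)$ ($r\in k$), mirror images $\Delta^{op}:(2,1)$, $!^{op}:(0,1)$, $\mu^{op}:(1,2)$, $\mathsf 0^{op}:(1,0)$, $\mathsf 1^{op}:(1,0)$, $\mathsf x^{op}:(1,1)$, $\mathsf s_r^{op}:(1,1)$, and $\mathrm{id}_0:(0,0)$, $\mathrm{id}_1:(1,1)$, $\mathrm{sw}:(2,2)$; closed under $c;d$ ($(n,z),(z,m)\mapsto(n,m)$) and $c\oplus d$ ($(n,m),(r,z)\mapsto(n+r,m+z)$). Feedback: for $c:(n+1,m+1)$, $\mathrm{Tr}(c)=(\eta\oplus\mathrm{id}_n);(\mathrm{id}_1\oplus c);(\mathrm{id}_1\oplus\mathsf x\oplus\mathrm{id}_m);(\epsilon\oplus\mathrm{id}_m):(n,m)$ with $\eta=!^{op};\Delta:(0,2)$, $\epsilon=\Delta^{op};!:(2,0)$ (feeding the first right port of $c$ through a register back into its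 first left port). Affine signal flow graphs form the smallest class of circuits containing $\Delta,!,\mu,\mathsf 0,\mathsf 1,\mathsf x,\mathsf s_r,\mathrm{id}_0,\mathrm{id}_1,\mathrm{sw}$ and closed under $;$, $\oplus$ and $\mathrm{Tr}$. Operational semantics: a state stores a value of $k$ in each occurrence of $\mathsf x$ and $\mathsf x^{op}$; the initial state stores $0$ everywhere. Transitions $t\vdash c\to t+1\vdash c'$ carry labels "left / right" generated by (all $a,b\in k$): $\Delta$: $a$ / $(a,a)$; $!$: $a$ / $\bullet$; $\mu$: $(a,b)$ / $a+b$; $\mathsf 0$: $\bullet$ / $0$; $\mathsf s_r$: $b$ / $rb$; $\mathsf x$ storing $b$: $a$ / $b$, new state stores $a$; $\mathsf 1$: $\bullet$ / $1$ if $t=0$, $\bullet$ / $0$ if $t\neq0$; $\Delta^{op}$: $(a,a)$ / $a$; $!^{op}$: $\bullet$ / $a$; $\mu^{op}$: $a+b$ / $(a,b)$; $\mathsf 0^{op}$: $0$ / $\bullet$; $\mathsf s_r^{op}$: $rb$ / $b$; $\mathsf x^{op}$ storing $b$: $b$ / $a$, new state stores $a$; $\mathsf 1^{op}$: $1$ / $\bullet$ if $t=0$, $0$ / $\bullet$ otherwise; $\mathrm{id}_1$: $a$ / $a$; $\mathrm{sw}$: $(a,b)$ / $(b,a)$; $\mathrm{id}_0$: $\bullet$ / $\bullet$ ($\bullet$ the empty vector). If at time $t$, $c$ moves to $c'$ with $u$ / $v$ and $d$ to $d'$ with $v$ / $w$, then $c;d$ moves to $c';d'$ with $u$ / $w$;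 if $c$ moves with $u_1$ / $v_1$ and $d$ with $u_2$ / $v_2$, then $c\oplus d$ moves to $c'\oplus d'$ with $(u_1,u_2)$ / $(v_1,v_2)$. A computation starting at $t\le0$ is a sequence of transitions from the initial state, the $j$-th at time $t+j$. An $(n,m)$-trajectory is $\sigma:\mathbb Z\to k^n\times k^m$ equal to $(0,0)$ at all sufficiently negative indices; an infinite computation starting at $t$ with labels $(u_i,v_i)$ at time $i$ yields $\sigma(i)=(u_i,v_i)$ for $i\ge t$, $(0,0)$ for $i<t$; $\langle f\rangle$ is the set of trajectories of all infinite computations of $f$. -}

module Defs where

open import Data.Nat as ℕ using (ℕ; zero; suc)
open import Data.Integer as ℤ using (ℤ; +_)
open import Data.Vec using (Vec; []; _∷_; _++_; replicate)
open import Data.Product using (Σ; _×_; _,_; ∃-syntax; proj₁; proj₂)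
open import Data.Unit using (⊤; tt)
open import Data.List using (List; []; _∷_; length; lookup)
open import Data.Fin using (Fin; toℕ)
open import Relation.Nullary using (¬_)
open import Relation.Binary.PropositionalEquality using (_≡_)
open import Algebra.Core using (Op₁; Op₂)
open import Algebra.Structures using (IsCommutativeRing)

record Field : Set₁ where
  field
    Carrier : Set
    _+_ _*_ : Op₂ Carrier
    -_      : Op₁ Carrier
    0# 1#   : Carrier
    isCommutativeRing : IsCommutativeRing _≡_ _+_ _*_ -_ 0# 1#
    0≢1     : ¬ (0# ≡ 1#)
    inverse : ∀ x → ¬ (x ≡ 0#) → Σ Carrier (λ y → (x * y) ≡ 1#)

module Sem (F : Field) where
  open Field F renaming (Carrier to K)

  data Circ : ℕ → ℕ → Set where
    copy   : Circ 1 2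
    disc   : Circ 1 0
    add    : Circ 2 1
    zer    : Circ 0 1
    one    : Circ 0 1
    reg    : Circ 1 1
    amp    : K → Circ 1 1
    copyᵒᵖ : Circ 2 1
    discᵒᵖ : Circ 0 1
    addᵒᵖ  : Circ 1 2
    zerᵒᵖ  : Circ 1 0
    oneᵒᵖ  : Circ 1 0
    regᵒᵖ  : Circ 1 1
    ampᵒᵖ  : K → Circ 1 1
    id₀    : Circ 0 0
    id₁    : Circ 1 1
    sw     : Circ 2 2
    _⨾_    : ∀ {n z m} → Circ n z → Circ z m → Circ n m
    _⊕_    : ∀ {n m r z} → Circ n m → Circ r z → Circ (n ℕ.+ r) (m ℕ.+ z)

  infixl 5 _⨾_
  infixl 6 _⊕_

  η : Circ 0 2
  η = discᵒᵖ ⨾ copy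

  ε : Circ 2 0
  ε = copyᵒᵖ ⨾ disc

  idₙ : (n : ℕ) → Circ n n
  idₙ zero    = id₀
  idₙ (suc n) = id₁ ⊕ idₙ n

  Tr : ∀ {n m} → Circ (suc n) (suc m) → Circ n m
  Tr {n} {m} c = (η ⊕ idₙ n) ⨾ (id₁ ⊕ c) ⨾ (id₁ ⊕ reg ⊕ idₙ m) ⨾ (ε ⊕ idₙ m)

  data ASFG : ∀ {n m} → Circ n m → Set where
    copy : ASFG copy
    disc : ASFG disc
    add  : ASFG add
    zer  : ASFG zer
    one  : ASFG one
    reg  : ASFG reg
    amp  : ∀ r → ASFG (amp r)
    id₀  : ASFG id₀
    id₁  : ASFG id₁
    sw   : ASFG sw
    seq  : ∀ {n z m} {c : Circ n z} {d : Circ z m} → ASFG c → ASFG d → ASFG (c ⨾ d)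
    par  : ∀ {n m r z} {c : Circ n m} {d : Circ r z} → ASFG c → ASFG d → ASFG (c ⊕ d)
    tr   : ∀ {n m} {c : Circ (suc n) (suc m)} → ASFG c → ASFG (Tr c)

  State : ∀ {n m} → Circ n m → Set
  State reg       = K
  State regᵒᵖ     = K
  State (c ⨾ d)   = State c × State d
  State (c ⊕ d)   = State c × State d
  State _         = ⊤

  init : ∀ {n m} (c : Circ n m) → State c
  init copy     = tt
  init disc     = tt
  init add      = tt
  init zer      = tt
  init one      = tt
  init reg      = 0#
  init (amp r)  = tt
  init copyᵒᵖ   = tt
  init discᵒᵖ   = tt
  init addᵒᵖ    = tt
  init zerᵒᵖ    = tt
  init oneᵒᵖ    = tt
  init regᵒᵖ    = 0#
  init (ampᵒᵖ r) = tt
  init id₀      = tt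
  init id₁      = tt
  init sw       = tt
  init (c ⨾ d)  = init c , init d
  init (c ⊕ d)  = init c , init d

  oneAt : ℤ → K
  oneAt (+ zero) = 1#
  oneAt _        = 0#

  -- Transitions  t ⊢ (c , s) → t+1 ⊢ (c , s')  with label  u / v
  -- (a circuit only changes its state during a transition)

  data Step : ∀ {n m} → ℤ → (c : Circ n m) → State c → Vec K n → Vec K m → State c → Set where
    copy   : ∀ {t} a → Step t copy tt (a ∷ []) (a ∷ a ∷ []) tt
    disc   : ∀ {t} a → Step t disc tt (a ∷ []) [] tt
    add    : ∀ {t} a b → Step t add tt (a ∷ b ∷ []) ((a + b) ∷ []) tt
    zer    : ∀ {t} → Step t zer tt [] (0# ∷ []) tt
    one    : ∀ {t} → Step t one tt [] (oneAt t ∷ []) tt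
    reg    : ∀ {t} a b → Step t reg b (a ∷ []) (b ∷ []) a
    amp    : ∀ {t} r b → Step t (amp r) tt (b ∷ []) ((r * b) ∷ []) tt
    copyᵒᵖ : ∀ {t} a → Step t copyᵒᵖ tt (a ∷ a ∷ []) (a ∷ []) tt
    discᵒᵖ : ∀ {t} a → Step t discᵒᵖ tt [] (a ∷ []) tt
    addᵒᵖ  : ∀ {t} a b → Step t addᵒᵖ tt ((a + b) ∷ []) (a ∷ b ∷ []) tt
    zerᵒᵖ  : ∀ {t} → Step t zerᵒᵖ tt (0# ∷ []) [] tt
    oneᵒᵖ  : ∀ {t} → Step t oneᵒᵖ tt (oneAt t ∷ []) [] tt
    regᵒᵖ  : ∀ {t} a b → Step t regᵒᵖ b (b ∷ []) (a ∷ []) a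
    ampᵒᵖ  : ∀ {t} r b → Step t (ampᵒᵖ r) tt ((r * b) ∷ []) (b ∷ []) tt
    id₀    : ∀ {t} → Step t id₀ tt [] [] tt
    id₁    : ∀ {t} a → Step t id₁ tt (a ∷ []) (a ∷ []) tt
    sw     : ∀ {t} a b → Step t sw tt (a ∷ b ∷ []) (b ∷ a ∷ []) tt
    seq    : ∀ {t n z m} {c : Circ n z} {d : Circ z m} {s s' r r' u v w} →
             Step t c s u v s' → Step t d r v w r' →
             Step t (c ⨾ d) (s , r) u w (s' , r')
    par    : ∀ {t n m p q} {c : Circ n m} {d : Circ p q} {s s' r r' u₁ v₁ u₂ v₂} →
             Step t c s u₁ v₁ s' → Step t d r u₂ v₂ r' →
             Step t (c ⊕ d) (s , r) (u₁ ++ u₂) (v₁ ++ v₂) (s' , r')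

  Label : ℕ → ℕ → Set
  Label n m = Vec K n × Vec K m

  -- Finite computations  t ⊢ c₀ → c₁ → ⋯ → c_N  from state s;
  -- the j-th transition (0-indexed) happens at time t + j and its label
  -- is the j-th element of the list.

  data Run {n m} (c : Circ n m) : ℤ → State c → List (Label n m) → Set where
    done : ∀ {t s} → Run c t s []
    step : ∀ {t s s' u v ls} → Step t c s u v s' →
           Run c (ℤ.suc t) s' ls → Run c t s ((u , v) ∷ ls)

  record InfComp {n m} (c : Circ n m) (t : ℤ) : Set where
    field
      st    : ℕ → State c
      lab   : ℕ → Label n m
      start : st 0 ≡ init c
      steps : ∀ j → Step (t ℤ.+ + j) c (st j) (proj₁ (lab j)) (proj₂ (lab j)) (st (suc j))

  zeroLabel : ∀ {n m} → Label n m
  zeroLabel = replicate _ 0# , replicate _ 0#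

  Traj : ℕ → ℕ → Set
  Traj n m = ℤ → Label n m

  IsTrajectory : ∀ {n m} → Traj n m → Set
  IsTrajectory σ = ∃[ T ] (∀ i → i ℤ.≤ T → σ i ≡ zeroLabel)

  Yields : ∀ {n m} {c : Circ n m} {t : ℤ} → InfComp c t → Traj n m → Set
  Yields {t = t} κ σ =
    (∀ (j : ℕ) → σ (t ℤ.+ + j) ≡ InfComp.lab κ j) ×
    (∀ i → i ℤ.< t → σ i ≡ zeroLabel)

  ⟨_⟩∋_ : ∀ {n m} → Circ n m → Traj n m → Set
  ⟨ c ⟩∋ σ = IsTrajectory σ ×
             ∃[ t ] (t ℤ.≤ + 0 × ∃[ κ ] Yields {c = c} {t = t} κ σ)

-- Affine signal flow graphs never deadlock: in every state, at every time and
-- for every left input there is a transition.  For a feedback loop this holds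
-- because the value fed back into the circuit at time t is the one stored in
-- the loop's register, which is already known, so no fixed point has to be
-- found.  Hence a finite computation can be continued forever (say with zero
-- inputs), and the trajectory of that infinite computation, padded with zeros
-- before its starting time, extends the given labels.
module Submission where

open import Defs
open import Data.Nat using (ℕ; zero; suc; z≤n)
open import Data.Integer as ℤ using (ℤ; +_; -[1+_])
import Data.Integer.Properties as ℤ
open import Algebra.Properties.AbelianGroup ℤ.+-0-abelianGroup using (xyx⁻¹≈y)
open import Data.Product using (_×_; ∃-syntax; Σ-syntax; _,_; proj₁; proj₂)
open import Data.List using (List; length; lookup)
open import Data.Fin using (Fin; toℕ)
import Data.Fin as Fin
open import Data.Vec using (Vec; []; _∷_; _++_; splitAt; replicate)
open import Data.Unit using (tt)
open import Data.Empty using (⊥-elim)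
open import Relation.Binary.PropositionalEquality
  using (_≡_; refl; sym; trans; cong; subst; module ≡-Reasoning)

suc+≡+suc : ∀ t j → ℤ.suc t ℤ.+ + j ≡ t ℤ.+ + suc j
suc+≡+suc t j = begin
  ℤ.suc t ℤ.+ + j       ≡⟨ cong (ℤ._+ + j) (ℤ.+-comm (+ 1) t) ⟩
  t ℤ.+ + 1 ℤ.+ + j     ≡⟨ ℤ.+-assoc t (+ 1) (+ j) ⟩
  t ℤ.+ + suc j         ∎
  where open ≡-Reasoning

module _ (F : Field) where
  open Field F renaming (Carrier to K)
  open Sem F

  Total : ∀ {n m} → Circ n m → Set
  Total {n} {m} c =
    ∀ t s (u : Vec K n) → Σ[ v ∈ Vec K m ] Σ[ s' ∈ State c ] Step t c s u v s'

  idₙ-step : ∀ {t} n s (u : Vec K n) → Step t (idₙ n) s u u s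
  idₙ-step zero    tt       []      = id₀
  idₙ-step (suc n) (tt , s) (a ∷ u) = par (id₁ a) (idₙ-step n s u)

  Tr-total : ∀ {n m} {c : Circ (suc n) (suc m)} → Total c → Total (Tr c)
  -- b is the value held by the feedback register.
  Tr-total {n} {m} total t
    (((((tt , tt) , sη) , (tt , sc)) , ((tt , b) , sx)) , ((tt , tt) , sε)) u
    with total t sc (b ∷ u)
  ... | y ∷ v , sc' , c-step =
    v , (((((tt , tt) , sη) , (tt , sc')) , ((tt , y) , sx)) , ((tt , tt) , sε)) ,
    seq (seq (seq (par (seq (discᵒᵖ b) (copy b)) (idₙ-step n sη u))
                  (par (id₁ b) c-step))
             (par (par (id₁ b) (reg y b)) (idₙ-step m sx v)))
        (par (seq (copyᵒᵖ b) (disc b)) (idₙ-step m sε v))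

  ASFG-total : ∀ {n m} {c : Circ n m} → ASFG c → Total c
  ASFG-total copy    t tt (a ∷ [])     = _ , _ , copy a
  ASFG-total disc    t tt (a ∷ [])     = _ , _ , disc a
  ASFG-total add     t tt (a ∷ b ∷ []) = _ , _ , add a b
  ASFG-total zer     t tt []           = _ , _ , zer
  ASFG-total one     t tt []           = _ , _ , one
  ASFG-total reg     t b  (a ∷ [])     = _ , _ , reg a b
  ASFG-total (amp r) t tt (a ∷ [])     = _ , _ , amp r a
  ASFG-total id₀     t tt []           = _ , _ , id₀
  ASFG-total id₁     t tt (a ∷ [])     = _ , _ , id₁ a
  ASFG-total sw      t tt (a ∷ b ∷ []) = _ , _ , sw a b
  ASFG-total (seq p q) t (s , r) u with ASFG-total p t s u
  ... | v , s' , c-step with ASFG-total q t r v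
  ... | w , r' , d-step = w , (s' , r') , seq c-step d-step
  ASFG-total (par {n = n} p q) t (s , r) u with splitAt n u
  ... | u₁ , u₂ , refl with ASFG-total p t s u₁ | ASFG-total q t r u₂
  ... | v₁ , s' , c-step | v₂ , r' , d-step = v₁ ++ v₂ , (s' , r') , par c-step d-step
  ASFG-total (tr p) = Tr-total (ASFG-total p)

  record InfCompFrom {n m} (c : Circ n m) (t : ℤ) (s : State c) : Set where
    field
      st    : ℕ → State c
      lab   : ℕ → Label n m
      start : st 0 ≡ s
      steps : ∀ j → Step (t ℤ.+ + j) c (st j) (proj₁ (lab j)) (proj₂ (lab j)) (st (suc j))
  open InfCompFrom

  module _ {n m} {c : Circ n m} where

    retime : ∀ {τ τ' s u v s'} → τ ≡ τ' → Step τ c s u v s' → Step τ' c s u v s'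
    retime refl c-step = c-step

    prepend : ∀ {t s u v s'} → Step t c s u v s' →
              InfCompFrom c (ℤ.suc t) s' → InfCompFrom c t s
    prepend {t} {s} {u} {v} c-step κ = record
      { st    = λ { zero → s ; (suc j) → st κ j }
      ; lab   = λ { zero → u , v ; (suc j) → lab κ j }
      ; start = refl
      ; steps = λ
        { zero    → retime (sym (ℤ.+-identityʳ t))
                      (subst (Step t c s u v) (sym (start κ)) c-step)
        ; (suc j) → retime (suc+≡+suc t j) (steps κ j)
        }
      }

    module _ (total : Total c) where

      private
        zeros : Vec K n
        zeros = replicate n 0#

        idle-next : ℤ → State c → State c
        idle-next t s = proj₁ (proj₂ (total t s zeros))

        idle-st : ℤ → State c → ℕ → State c
        idle-st t s zero    = s
        idle-st t s (suc j) = idle-st (ℤ.suc t) (idle-next t s) j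

        idle-lab : ℤ → State c → ℕ → Label n m
        idle-lab t s zero    = zeros , proj₁ (total t s zeros)
        idle-lab t s (suc j) = idle-lab (ℤ.suc t) (idle-next t s) j

        idle-steps : ∀ t s j → Step (t ℤ.+ + j) c (idle-st t s j)
          (proj₁ (idle-lab t s j)) (proj₂ (idle-lab t s j)) (idle-st t s (suc j))
        idle-steps t s zero    = retime (sym (ℤ.+-identityʳ t)) (proj₂ (proj₂ (total t s zeros)))
        idle-steps t s (suc j) = retime (suc+≡+suc t j) (idle-steps (ℤ.suc t) (idle-next t s) j)

      idle : ∀ t s → InfCompFrom c t s
      idle t s = record
        { st = idle-st t s ; lab = idle-lab t s ; start = refl ; steps = idle-steps t s }

      Run-extend : ∀ {t s ls} → Run c t s ls →
                   Σ[ κ ∈ InfCompFrom c t s ] (∀ j → lab κ (toℕ j) ≡ lookup ls j)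
      Run-extend {t} {s} done = idle t s , λ ()
      Run-extend (step c-step run) with Run-extend run
      ... | κ , agrees = prepend c-step κ , λ
        { Fin.zero → refl ; (Fin.suc j) → agrees j }

  module _ {n m} (t : ℤ) (l : ℕ → Label n m) where

    private
      fromStart : ℤ → Label n m
      fromStart (+ k)     = l k
      fromStart -[1+ _ ]  = zeroLabel

    trajectory : Traj n m
    trajectory i = fromStart (i ℤ.- t)

    trajectory-after : ∀ j → trajectory (t ℤ.+ + j) ≡ l j
    trajectory-after j = cong fromStart (xyx⁻¹≈y t (+ j))

    trajectory-before : ∀ i → i ℤ.< t → trajectory i ≡ zeroLabel
    trajectory-before i i<t with i ℤ.- t in i-t≡
    ... | -[1+ _ ] = refl
    ... | + k      = ⊥-elim (ℤ.<⇒≱ i<t t≤i)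
      where
        t≤i : t ℤ.≤ i
        t≤i = ℤ.0≤i-j⇒j≤i (subst (+ 0 ℤ.≤_) (sym i-t≡) (ℤ.+≤+ z≤n))

  ⟨⟩∋trajectory : ∀ {n m} {c : Circ n m} {t} → t ℤ.≤ + 0 →
                  (κ : InfCompFrom c t (init c)) → ⟨ c ⟩∋ trajectory t (lab κ)
  ⟨⟩∋trajectory {t = t} t≤0 κ =
    (ℤ.pred t , λ i i≤pred[t] → trajectory-before t (lab κ) i (ℤ.i≤pred[j]⇒i<j i≤pred[t])) ,
    t , t≤0 ,
    record { st = st κ ; lab = lab κ ; start = start κ ; steps = steps κ } ,
    trajectory-after t (lab κ) , trajectory-before t (lab κ)

proposition9 : (F : Field) → let open Sem F in
    ∀ {n m} (f : Circ n m) → ASFG f →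
    ∀ (t : ℤ) → t ℤ.≤ + 0 →
    ∀ (ls : List (Label n m)) → Run f t (init f) ls →
    ∃[ σ ] ((⟨ f ⟩∋ σ) × (∀ (j : Fin (length ls)) → σ (t ℤ.+ + toℕ j) ≡ lookup ls j))
proposition9 F f asfg t t≤0 ls run =
  let κ , agrees = Run-extend F (ASFG-total F asfg) run in
  trajectory F t (InfCompFrom.lab κ) ,
  ⟨⟩∋trajectory F t≤0 κ ,
  λ j → trans (trajectory-after F t (InfCompFrom.lab κ) (toℕ j)) (agrees j)
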